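{- Let $\mathcal{D}\subseteq\mathbb{N}$, let $f\colon\{2\}\cup\mathcal{D}\to\mathbb{N}$, let $k\le n$, and suppose $E\colon\binom{[2n]}{k}\to\{0,1\}^m$ is an $f$-code. Then for all $x,y\in\binom{[2n]}{k}$, \[\mathrm{dist}(E(x),E(y))\le \tfrac{f(2)}{2}\,\mathrm{dist}(x,y).\]
   Context: $\binom{[2n]}{k}$ is the set of strings in $\{0,1\}^{2n}$ of Hamming weight $k$, and $\mathrm{dist}$ is Hamming distance. $E\colon\mathcal{X}\to\{0,1\}^m$ is an $f$-code if $\mathrm{dist}(E(x),E(y))=f(\mathrm{dist}(x,y))$ for all $x,y\in\mathcal{X}$ with $\mathrm{dist}(x,y)$ in the domain of $f$. -}

module Defs where

open import Data.Nat using (ℕ; zero; suc; _+_)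
open import Data.Bool using (Bool; true; false)
open import Data.Vec using (Vec; []; _∷_)
open import Data.Sum using (_⊎_)
open import Relation.Binary.PropositionalEquality using (_≡_)

weight : ∀ {n} → Vec Bool n → ℕ
weight [] = 0
weight (true ∷ xs) = suc (weight xs)
weight (false ∷ xs) = weight xs

dist : ∀ {n} → Vec Bool n → Vec Bool n → ℕ
dist [] [] = 0
dist (true ∷ xs) (false ∷ ys) = suc (dist xs ys)
dist (false ∷ xs) (true ∷ ys) = suc (dist xs ys)
dist (true ∷ xs) (true ∷ ys) = dist xs ys
dist (false ∷ xs) (false ∷ ys) = dist xs ys

-- E : X → {0,1}^m is an f-code on X, where the domain of f is the
-- subset of ℕ given by the predicate Dom (f is given as a total function
-- whose values outside Dom are irrelevant).
IsFCode : ∀ {ℓ} {N m : ℕ} (X : Vec Bool N → Set ℓ) (Dom : ℕ → Set ℓ)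
          (f : ℕ → ℕ) (E : Vec Bool N → Vec Bool m) → Set ℓ
IsFCode {N = N} X Dom f E =
  ∀ (x y : Vec Bool N) → X x → X y → Dom (dist x y) →
  dist (E x) (E y) ≡ f (dist x y)

Slice : (k : ℕ) {N : ℕ} → Vec Bool N → Set
Slice k x = weight x ≡ k

{-# OPTIONS --safe #-}
module Submission where

-- For x, y of equal weight, the positions where x and y differ split evenly into
-- 1→0 and 0→1 positions, c of each, so dist x y = 2c. Swapping one 1→0 and one
-- 0→1 position of x gives z in the same slice with dist x z = 2 and c − 1 of each
-- kind left, so the code maps x and z at distance f 2 apart. Iterating and using
-- the triangle inequality in {0,1}^m gives dist (E x) (E y) ≤ c · f 2.

open import Defs
open import Data.Nat using (ℕ; _+_; _*_; _≤_; zero; suc; z≤n; s≤s)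
open import Data.Nat.Properties
open import Algebra.Properties.CommutativeSemigroup *-commutativeSemigroup using (x∙yz≈y∙xz)
open import Data.Bool using (Bool; true; false)
open import Data.Vec using (Vec; []; _∷_)
open import Data.Sum using (_⊎_; inj₁)
open import Data.Product using (_×_; _,_; ∃-syntax)
open import Relation.Binary.PropositionalEquality

private
  variable
    N : ℕ
    a b c : ℕ

dist₁₀ : Vec Bool N → Vec Bool N → ℕ
dist₁₀ [] [] = 0
dist₁₀ (true ∷ xs) (false ∷ ys) = suc (dist₁₀ xs ys)
dist₁₀ (false ∷ xs) (true ∷ ys) = dist₁₀ xs ys
dist₁₀ (true ∷ xs) (true ∷ ys) = dist₁₀ xs ys
dist₁₀ (false ∷ xs) (false ∷ ys) = dist₁₀ xs ys

dist≡dist₁₀+dist₁₀ : (x y : Vec Bool N) → dist x y ≡ dist₁₀ x y + dist₁₀ y x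
dist≡dist₁₀+dist₁₀ [] [] = refl
dist≡dist₁₀+dist₁₀ (true ∷ xs) (false ∷ ys) = cong suc (dist≡dist₁₀+dist₁₀ xs ys)
dist≡dist₁₀+dist₁₀ (false ∷ xs) (true ∷ ys) =
  trans (cong suc (dist≡dist₁₀+dist₁₀ xs ys)) (sym (+-suc _ _))
dist≡dist₁₀+dist₁₀ (true ∷ xs) (true ∷ ys) = dist≡dist₁₀+dist₁₀ xs ys
dist≡dist₁₀+dist₁₀ (false ∷ xs) (false ∷ ys) = dist≡dist₁₀+dist₁₀ xs ys

weight+dist₁₀ : (x y : Vec Bool N) → weight x + dist₁₀ y x ≡ weight y + dist₁₀ x y
weight+dist₁₀ [] [] = refl
weight+dist₁₀ (true ∷ xs) (false ∷ ys) = trans (cong suc (weight+dist₁₀ xs ys)) (sym (+-suc _ _))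
weight+dist₁₀ (false ∷ xs) (true ∷ ys) = trans (+-suc _ _) (cong suc (weight+dist₁₀ xs ys))
weight+dist₁₀ (true ∷ xs) (true ∷ ys) = cong suc (weight+dist₁₀ xs ys)
weight+dist₁₀ (false ∷ xs) (false ∷ ys) = weight+dist₁₀ xs ys

dist₁₀-sym : (x y : Vec Bool N) → weight x ≡ weight y → dist₁₀ x y ≡ dist₁₀ y x
dist₁₀-sym x y wx≡wy = sym (+-cancelˡ-≡ (weight y) _ _ (begin
  weight y + dist₁₀ y x ≡⟨ cong (_+ dist₁₀ y x) wx≡wy ⟨
  weight x + dist₁₀ y x ≡⟨ weight+dist₁₀ x y ⟩
  weight y + dist₁₀ x y ∎))
  where open ≡-Reasoning

dist≡2*dist₁₀ : (x y : Vec Bool N) → weight x ≡ weight y → dist x y ≡ 2 * dist₁₀ x y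
dist≡2*dist₁₀ x y wx≡wy = begin
  dist x y                  ≡⟨ dist≡dist₁₀+dist₁₀ x y ⟩
  dist₁₀ x y + dist₁₀ y x   ≡⟨ cong (dist₁₀ x y +_) (dist₁₀-sym x y wx≡wy) ⟨
  dist₁₀ x y + dist₁₀ x y   ≡⟨ cong (dist₁₀ x y +_) (+-identityʳ (dist₁₀ x y)) ⟨
  2 * dist₁₀ x y            ∎
  where open ≡-Reasoning

dist-refl : (x : Vec Bool N) → dist x x ≡ 0
dist-refl [] = refl
dist-refl (true ∷ xs) = dist-refl xs
dist-refl (false ∷ xs) = dist-refl xs

dist≡0⇒≡ : (x y : Vec Bool N) → dist x y ≡ 0 → x ≡ y
dist≡0⇒≡ [] [] _ = refl
dist≡0⇒≡ (true ∷ xs) (true ∷ ys) eq = cong (true ∷_) (dist≡0⇒≡ xs ys eq)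
dist≡0⇒≡ (false ∷ xs) (false ∷ ys) eq = cong (false ∷_) (dist≡0⇒≡ xs ys eq)

≤⇒suc≤-+-suc : a ≤ b + c → suc a ≤ b + suc c
≤⇒suc≤-+-suc {a} {b} a≤b+c = subst (suc a ≤_) (sym (+-suc b _)) (s≤s a≤b+c)

≤⇒≤suc-+-suc : a ≤ b + c → a ≤ suc (b + suc c)
≤⇒≤suc-+-suc {b = b} {c} a≤b+c = m≤n⇒m≤1+n (≤-trans a≤b+c (+-monoʳ-≤ b (n≤1+n c)))

dist-triangle : (x y z : Vec Bool N) → dist x z ≤ dist x y + dist y z
dist-triangle [] [] [] = z≤n
dist-triangle (true ∷ xs) (true ∷ ys) (true ∷ zs) = dist-triangle xs ys zs
dist-triangle (true ∷ xs) (true ∷ ys) (false ∷ zs) = ≤⇒suc≤-+-suc (dist-triangle xs ys zs)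
dist-triangle (true ∷ xs) (false ∷ ys) (true ∷ zs) = ≤⇒≤suc-+-suc (dist-triangle xs ys zs)
dist-triangle (true ∷ xs) (false ∷ ys) (false ∷ zs) = s≤s (dist-triangle xs ys zs)
dist-triangle (false ∷ xs) (true ∷ ys) (true ∷ zs) = s≤s (dist-triangle xs ys zs)
dist-triangle (false ∷ xs) (true ∷ ys) (false ∷ zs) = ≤⇒≤suc-+-suc (dist-triangle xs ys zs)
dist-triangle (false ∷ xs) (false ∷ ys) (true ∷ zs) = ≤⇒suc≤-+-suc (dist-triangle xs ys zs)
dist-triangle (false ∷ xs) (false ∷ ys) (false ∷ zs) = dist-triangle xs ys zs

flip-one-to-zero : (x y : Vec Bool N) → dist₁₀ x y ≡ suc c →
  ∃[ x′ ] suc (weight x′) ≡ weight x × dist₁₀ x′ y ≡ c × dist₁₀ y x′ ≡ dist₁₀ y x × dist x x′ ≡ 1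
flip-one-to-zero [] [] ()
flip-one-to-zero (true ∷ xs) (false ∷ ys) refl =
  false ∷ xs , refl , refl , refl , cong suc (dist-refl xs)
flip-one-to-zero (false ∷ xs) (true ∷ ys) eq with flip-one-to-zero xs ys eq
... | x′ , w , d₁₀ , d₀₁ , d = false ∷ x′ , w , d₁₀ , cong suc d₀₁ , d
flip-one-to-zero (true ∷ xs) (true ∷ ys) eq with flip-one-to-zero xs ys eq
... | x′ , w , d₁₀ , d₀₁ , d = true ∷ x′ , cong suc w , d₁₀ , d₀₁ , d
flip-one-to-zero (false ∷ xs) (false ∷ ys) eq with flip-one-to-zero xs ys eq
... | x′ , w , d₁₀ , d₀₁ , d = false ∷ x′ , w , d₁₀ , d₀₁ , d

flip-zero-to-one : (x y : Vec Bool N) → dist₁₀ y x ≡ suc c →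
  ∃[ x′ ] weight x′ ≡ suc (weight x) × dist₁₀ y x′ ≡ c × dist₁₀ x′ y ≡ dist₁₀ x y × dist x x′ ≡ 1
flip-zero-to-one [] [] ()
flip-zero-to-one (false ∷ xs) (true ∷ ys) refl =
  true ∷ xs , refl , refl , refl , cong suc (dist-refl xs)
flip-zero-to-one (true ∷ xs) (false ∷ ys) eq with flip-zero-to-one xs ys eq
... | x′ , w , d₀₁ , d₁₀ , d = true ∷ x′ , cong suc w , d₀₁ , cong suc d₁₀ , d
flip-zero-to-one (true ∷ xs) (true ∷ ys) eq with flip-zero-to-one xs ys eq
... | x′ , w , d₀₁ , d₁₀ , d = true ∷ x′ , cong suc w , d₀₁ , d₁₀ , d
flip-zero-to-one (false ∷ xs) (false ∷ ys) eq with flip-zero-to-one xs ys eq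
... | x′ , w , d₀₁ , d₁₀ , d = false ∷ x′ , w , d₀₁ , d₁₀ , d

swap-one-pair : (x y : Vec Bool N) → dist₁₀ x y ≡ suc a → dist₁₀ y x ≡ suc b →
  ∃[ z ] weight z ≡ weight x × dist₁₀ z y ≡ a × dist₁₀ y z ≡ b × dist x z ≡ 2
swap-one-pair {a = a} {b} x y x₁₀y y₁₀x
  with x′ , w′ , x′₁₀y , y₁₀x′ , x-x′ ← flip-one-to-zero x y x₁₀y
  with z , w , y₁₀z , z₁₀y , x′-z ← flip-zero-to-one x′ y (trans y₁₀x′ y₁₀x) =
  z , trans w w′ , trans z₁₀y x′₁₀y , y₁₀z , ≤-antisym x-z≤2 2≤x-z
  where
  open ≤-Reasoning
  z-y : dist z y ≡ a + b
  z-y = trans (dist≡dist₁₀+dist₁₀ z y) (cong₂ _+_ (trans z₁₀y x′₁₀y) y₁₀z)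
  x-z≤2 : dist x z ≤ 2
  x-z≤2 = begin
    dist x z              ≤⟨ dist-triangle x x′ z ⟩
    dist x x′ + dist x′ z ≡⟨ cong₂ _+_ x-x′ x′-z ⟩
    2                     ∎
  2≤x-z : 2 ≤ dist x z
  2≤x-z = +-cancelʳ-≤ (a + b) 2 (dist x z) (begin
    2 + (a + b)           ≡⟨ cong suc (+-suc a b) ⟨
    suc a + suc b         ≡⟨ cong₂ _+_ x₁₀y y₁₀x ⟨
    dist₁₀ x y + dist₁₀ y x ≡⟨ dist≡dist₁₀+dist₁₀ x y ⟨
    dist x y              ≤⟨ dist-triangle x z y ⟩
    dist x z + dist z y   ≡⟨ cong (dist x z +_) z-y ⟩
    dist x z + (a + b)    ∎)

module _ {N m k : ℕ} {Dom : ℕ → Set} {f : ℕ → ℕ} {E : Vec Bool N → Vec Bool m}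
         (E-code : IsFCode (Slice k) Dom f E) (2∈Dom : Dom 2) where

  slice-code-dist≤ : (x y : Vec Bool N) → weight x ≡ k → weight y ≡ k →
    dist (E x) (E y) ≤ f 2 * dist₁₀ x y
  slice-code-dist≤ x y wx wy = go (dist₁₀ x y) x y refl wx wy
    where
    go : ∀ c (x y : Vec Bool N) → dist₁₀ x y ≡ c → weight x ≡ k → weight y ≡ k →
      dist (E x) (E y) ≤ f 2 * c
    go zero x y x₁₀y wx wy
      with refl ← dist≡0⇒≡ x y (trans (dist≡2*dist₁₀ x y (trans wx (sym wy)))
                                      (cong (2 *_) x₁₀y)) =
      ≤-trans (≤-reflexive (dist-refl (E x))) z≤n
    go (suc c) x y x₁₀y wx wy
      with z , wz , z₁₀y , _ , x-z ← swap-one-pair x y x₁₀y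
             (trans (sym (dist₁₀-sym x y (trans wx (sym wy)))) x₁₀y) = begin
      dist (E x) (E y)            ≤⟨ dist-triangle (E x) (E z) (E y) ⟩
      dist (E x) (E z) + dist (E z) (E y)
        ≤⟨ +-mono-≤ (≤-reflexive Ex-Ez) (go c z y z₁₀y (trans wz wx) wy) ⟩
      f 2 + f 2 * c               ≡⟨ *-suc (f 2) c ⟨
      f 2 * suc c                 ∎
      where
      open ≤-Reasoning
      Ex-Ez : dist (E x) (E z) ≡ f 2
      Ex-Ez = trans (E-code x z wx (trans wz wx) (subst Dom (sym x-z) 2∈Dom)) (cong f x-z)

proposition3p8 : (D : ℕ → Set) (f : ℕ → ℕ) (n k m : ℕ) → k ≤ n →
    (E : Vec Bool (n + n) → Vec Bool m) →
    IsFCode (Slice k) (λ d → d ≡ 2 ⊎ D d) f E →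
    ∀ (x y : Vec Bool (n + n)) → weight x ≡ k → weight y ≡ k →
    2 * dist (E x) (E y) ≤ f 2 * dist x y
proposition3p8 D f n k m _ E E-code x y wx wy = begin
  2 * dist (E x) (E y)    ≤⟨ *-monoʳ-≤ 2 code-bound ⟩
  2 * (f 2 * dist₁₀ x y)  ≡⟨ x∙yz≈y∙xz 2 (f 2) (dist₁₀ x y) ⟩
  f 2 * (2 * dist₁₀ x y)  ≡⟨ cong (f 2 *_) (dist≡2*dist₁₀ x y (trans wx (sym wy))) ⟨
  f 2 * dist x y          ∎
  where
  open ≤-Reasoning
  code-bound : dist (E x) (E y) ≤ f 2 * dist₁₀ x y
  code-bound = slice-code-dist≤ {Dom = λ d → d ≡ 2 ⊎ D d} {f} {E} E-code (inj₁ refl) x y wx wy
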